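{- Let $D$ be a semi-regular (II) rectangular design with parameters $v=mn,b,r,k,\lambda_1,\lambda_2,\lambda_3,m,n$ with respect to the $m\times n$ array $A$, i.e. $\theta_2:=r-\lambda_2+(n-1)(\lambda_1-\lambda_3)=0$ while $\theta_1:=r-\lambda_1+(m-1)(\lambda_2-\lambda_3)>0$ and $\theta_3:=r-\lambda_1-\lambda_2+\lambda_3>0$. Then: (i) $m$ divides $k$, and if $\alpha=k/m$, then every block of $D$ contains exactly $\alpha$ treatments of each row of $A$; (ii) $D$ is uniform column tactical decomposable (with respect to the partition of the rows of its incidence matrix according to the rows of $A$); (iii) the dual of $D$ is $\alpha$-resolvable; (iv) if $D$ is self-dual, then it is $\alpha$-resolvable and square tactical decomposable STD$(n)$; (v) if $D$ is self-dual, then for each $s$ with $1\le s\le m-1$ there exists a semi-regular $\alpha$-resolvable rectangular design $D'$ with parameters $v'=(m-s)n$, $m'=m-s$, $n'=n$, $k'=\alpha(m-s)$ and the same $\lambda_1,\lambda_2,\lambda_3$.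
   Context: Let $m,n$ be positive integers and arrange $v=mn$ treatments in an $m\times n$ array $A$ (row $i$ consists of treatments $(i-1)n+1,\dots,in$). A rectangular design (RD) with parameters $v=mn,b,r,k,\lambda_1,\lambda_2,\lambda_3,m,n$ is a collection of $b$ blocks, each a set of $k$ distinct treatments, such that every treatment lies in exactly $r$ blocks, any two distinct treatments in the same row of $A$ occur together in exactly $\lambda_1$ blocks, any two in the same column of $A$ in exactly $\lambda_2$ blocks, and any other two distinct treatments in exactly $\lambda_3$ blocks. Its incidence matrix $N$ is the $v\times b$ $(0,1)$-matrix with rows ordered as in $A$. The dual of $D$ is the design with incidence matrix $N^T$; $D$ is self-dual if its dual is an RD with the same parameters (so $v=b$, $r=k$). A partition $N=[N_{ij}]$ into submatrices is column tactical if each $N_{ij}$ has constant column sums $k_{ij}$, row tactical if each $N_{ij}$ has constant row sums $r_{ij}$, and tactical if both; $D$ is uniform column tactical decomposable if there is a column tactical partition with all $k_{ij}$ equal. $D$ is square tactical decomposable STD$(n)$ if $N$ has a tactical partition into $n\times n$ submatrices. A design with $v$ treatments, $b$ blocks of size $k$, replication $r$ is $\alpha$-resolvable if its blocks can be partitioned into $r/\alpha$ classes of $v\alpha/k$ blocks each such that every treatment occurs in exactly $\alpha$ blocks of each class (equivalently $N=(N_1|\cdots|N_{r/\alpha})$ with every row sum of each $N_i$ equal to $\alpha$). -}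

module Defs where

open import Data.Nat using (ℕ; zero; suc; _+_; _*_; _∸_)
open import Data.Bool using (Bool; true; false; _∧_; if_then_else_)
open import Data.Fin using (Fin; combine; cast; quotient)
import Data.Fin.Properties as FinP
open import Data.Integer as ℤ using (ℤ; +_; 0ℤ; 1ℤ)
open import Data.Product using (Σ; ∃; _×_; _,_)
open import Relation.Nullary.Decidable using (⌊_⌋)
open import Relation.Binary.PropositionalEquality using (_≡_; _≢_; sym)

count : ∀ {n} → (Fin n → Bool) → ℕ
count {zero}  f = 0
count {suc n} f = (if f Fin.zero then 1 else 0) + count (λ i → f (Fin.suc i))
  where import Data.Fin as Fin

_==_ : ∀ {n} → Fin n → Fin n → Bool
x == y = ⌊ x FinP.≟ y ⌋

-- incidence matrix: v treatments (rows) × b blocks (columns)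
Incidence : ℕ → ℕ → Set
Incidence v b = Fin v → Fin b → Bool

transpose : ∀ {v b} → Incidence v b → Incidence b v
transpose N y x = N x y

concurrence : ∀ {v b} → Incidence v b → Fin v → Fin v → ℕ
concurrence N x y = count (λ c → N x c ∧ N y c)

-- Treatment in row i, column j of the m × n array A is  combine i j  = i * n + j
-- (0-indexed), i.e. treatment (i-1)n+j in 1-indexed numbering.
record IsRD (m n b r k l₁ l₂ l₃ : ℕ) (N : Incidence (m * n) b) : Set where
  field
    blockSize   : ∀ c → count (λ x → N x c) ≡ k
    replication : ∀ x → count (λ c → N x c) ≡ r
    sameRow     : ∀ (i : Fin m) (j j′ : Fin n) → j ≢ j′ →
                  concurrence N (combine i j) (combine i j′) ≡ l₁
    sameCol     : ∀ (i i′ : Fin m) (j : Fin n) → i ≢ i′ →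
                  concurrence N (combine i j) (combine i′ j) ≡ l₂
    other       : ∀ (i i′ : Fin m) (j j′ : Fin n) → i ≢ i′ → j ≢ j′ →
                  concurrence N (combine i j) (combine i′ j′) ≡ l₃

θ₁ : (m r l₁ l₂ l₃ : ℕ) → ℤ
θ₁ m r l₁ l₂ l₃ = ((+ r) ℤ.- (+ l₁)) ℤ.+ (((+ m) ℤ.- 1ℤ) ℤ.* ((+ l₂) ℤ.- (+ l₃)))

θ₂ : (n r l₁ l₂ l₃ : ℕ) → ℤ
θ₂ n r l₁ l₂ l₃ = ((+ r) ℤ.- (+ l₂)) ℤ.+ (((+ n) ℤ.- 1ℤ) ℤ.* ((+ l₁) ℤ.- (+ l₃)))

θ₃ : (r l₁ l₂ l₃ : ℕ) → ℤ
θ₃ r l₁ l₂ l₃ = (((+ r) ℤ.- (+ l₁)) ℤ.- (+ l₂)) ℤ.+ (+ l₃)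

SemiRegularII : (m n r l₁ l₂ l₃ : ℕ) → Set
SemiRegularII m n r l₁ l₂ l₃ =
  θ₂ n r l₁ l₂ l₃ ≡ 0ℤ × (0ℤ ℤ.< θ₁ m r l₁ l₂ l₃) × (0ℤ ℤ.< θ₃ r l₁ l₂ l₃)

-- Self-dual: b = mn and the dual (incidence matrix N^T, rows ordered by block
-- index, arranged in the m × n array in the same way) is an RD with the same parameters.
SelfDual : (m n b r k l₁ l₂ l₃ : ℕ) → Incidence (m * n) b → Set
SelfDual m n b r k l₁ l₂ l₃ N =
  Σ (b ≡ m * n) λ e →
    IsRD m n (m * n) r k l₁ l₂ l₃ (λ x y → N y (cast (sym e) x))

-- α-resolvable (design with v treatments, b blocks, replication r, block size k):
-- blocks partitioned into q = r/α classes (class of block y is γ y), each class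
-- having vα/k blocks, every treatment in exactly α blocks of each class.
Resolvable : (v b r k α : ℕ) → Incidence v b → Set
Resolvable v b r k α N =
  Σ ℕ λ q → Σ (Fin b → Fin q) λ γ →
    (q * α ≡ r)
    × (∀ c → count (λ y → γ y == c) * k ≡ v * α)
    × (∀ c x → count (λ y → (γ y == c) ∧ N x y) ≡ α)

colSum : ∀ {v b p} → Incidence v b → (Fin v → Fin p) → Fin p → Fin b → ℕ
colSum N ρ i c = count (λ x → (ρ x == i) ∧ N x c)

rowSum : ∀ {v b q} → Incidence v b → (Fin b → Fin q) → Fin q → Fin v → ℕ
rowSum N γ j x = count (λ y → (γ y == j) ∧ N x y)

Surjective : ∀ {a q} → (Fin a → Fin q) → Set
Surjective {a} γ = ∀ j → ∃ λ c → γ c ≡ j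

-- uniform column tactical decomposable, with the rows of N partitioned by ρ
-- (and some partition γ of the columns into nonempty parts): every submatrix N_ij
-- has constant column sum k_ij, and all the k_ij are equal (to κ).
UniformColumnTacticalWRT : ∀ {v b p} → Incidence v b → (Fin v → Fin p) → Set
UniformColumnTacticalWRT {v} {b} {p} N ρ =
  Σ ℕ λ q → Σ (Fin b → Fin q) λ γ → Surjective γ ×
    Σ ℕ λ κ → ∀ (i : Fin p) (j : Fin q) (c : Fin b) → γ c ≡ j → colSum N ρ i c ≡ κ

rowOfA : (m n : ℕ) → Fin (m * n) → Fin m
rowOfA m n = quotient n

SquareTacticalDecomposable : ∀ {v b} → ℕ → Incidence v b → Set
SquareTacticalDecomposable {v} {b} n N =
  Σ ℕ λ p → Σ ℕ λ q → Σ (Fin v → Fin p) λ ρ → Σ (Fin b → Fin q) λ γ →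
    (∀ i → count (λ x → ρ x == i) ≡ n)
    × (∀ j → count (λ y → γ y == j) ≡ n)
    × (∀ i j → Σ ℕ λ rij → ∀ x → ρ x ≡ i → rowSum N γ j x ≡ rij)
    × (∀ i j → Σ ℕ λ kij → ∀ c → γ c ≡ j → colSum N ρ i c ≡ kij)

-- Let a i B be the number of treatments of row i of A in block B. Counting pairs of treatments in
-- a common block, ∑_B a i B * a i′ B is n (r + (n - 1) λ₁) when i = i′ and n (λ₂ + (n - 1) λ₃)
-- otherwise; θ₂ = 0 says exactly that these agree, so ∑_B (a i B - a i′ B)² = 0. Hence every block
-- meets every row of A in the same number α = k / m of treatments, and (ii), (iii) merely regroup
-- this. For a self-dual design the same holds for the dual, which gives (iv). Keeping t ≤ m rows of
-- A preserves r and the λ's, and the new θ₁ = θ₃ + t (λ₂ - λ₃) is affine in t and positive at t = 0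
-- and t = m, so the restricted design is again semi-regular; this gives (v).
module Submission where

open import Defs
open import Data.Nat using (ℕ; zero; suc; _+_; _*_; _∸_; _≤_; _<_; z≤n; s≤s; ∣_-_∣; NonZero)
open import Data.Nat.Properties
open import Data.Nat.Divisibility using (_∣_; divides)
open import Data.Nat.DivMod using (_/_; m*n/n≡m)
import Data.Nat.Tactic.RingSolver as ℕ-Solver
import Algebra.Properties.CommutativeSemigroup +-commutativeSemigroup as +-Semigroup
import Algebra.Properties.CommutativeSemigroup *-commutativeSemigroup as *-Semigroup
open import Algebra.Properties.Semiring.Sum +-*-semiring
  using (sum; sum-syntax; sum-cong-≗; sum-remove; ∑-comm; ∑-distrib-+; *-distribˡ-sum; *-distribʳ-sum)
open import Data.Bool using (Bool; true; false; _∧_; if_then_else_)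
open import Data.Bool.Properties using (∧-identityʳ; ∧-idem)
open import Data.Fin using (Fin; zero; suc; combine; quotient; remainder; cast; inject≤; punchIn; _↑ˡ_; _↑ʳ_)
import Data.Fin.Properties as Finₚ
open import Data.Integer as ℤ using (0ℤ; 1ℤ; _⊖_)
import Data.Integer.Properties as ℤₚ
import Data.Integer.Tactic.RingSolver as ℤ-Solver
open import Data.Product using (Σ; _×_; _,_; proj₁; proj₂)
open import Data.Sum using (inj₁; inj₂; [_,_]′)
open import Function using (_∘_; id)
open import Function.Definitions using (Injective)
open import Relation.Binary.PropositionalEquality
  using (_≡_; _≢_; refl; sym; trans; cong; cong₂; subst; module ≡-Reasoning)
open import Relation.Nullary using (yes; no; contradiction)
open import Relation.Nullary.Decidable using (isYes≗does; dec-true; dec-false)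

ind : Bool → ℕ
ind b = if b then 1 else 0

count≡∑ : ∀ {n} (f : Fin n → Bool) → count f ≡ ∑[ i < n ] ind (f i)
count≡∑ {zero}  f = refl
count≡∑ {suc n} f = cong (ind (f zero) +_) (count≡∑ (f ∘ suc))

count-cong : ∀ {n} {f g : Fin n → Bool} → (∀ i → f i ≡ g i) → count f ≡ count g
count-cong {zero}  f≗g = refl
count-cong {suc n} f≗g = cong₂ _+_ (cong ind (f≗g zero)) (count-cong (f≗g ∘ suc))

count-true : ∀ n → count {n} (λ _ → true) ≡ n
count-true zero    = refl
count-true (suc n) = cong suc (count-true n)

count-false : ∀ n → count {n} (λ _ → false) ≡ 0
count-false zero    = refl
count-false (suc n) = count-false n

∑-const : ∀ n c → ∑[ i < n ] c ≡ n * c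
∑-const zero    c = refl
∑-const (suc n) c = cong (c +_) (∑-const n c)

∑≡0⇒≡0 : ∀ {n} (f : Fin n → ℕ) → sum f ≡ 0 → ∀ i → f i ≡ 0
∑≡0⇒≡0 f ∑f≡0 zero    = m+n≡0⇒m≡0 (f zero) ∑f≡0
∑≡0⇒≡0 f ∑f≡0 (suc i) = ∑≡0⇒≡0 (f ∘ suc) (m+n≡0⇒n≡0 (f zero) ∑f≡0) i

-- Stated with c added to the left-hand side so that no truncated subtraction n ∸ 1 appears.
∑-except : ∀ {n} (i : Fin n) (f : Fin n → ℕ) {c} → (∀ j → j ≢ i → f j ≡ c) →
           sum f + c ≡ f i + n * c
∑-except {suc n} i f {c} f≡c = begin
  sum f + c                      ≡⟨ cong (_+ c) (sum-remove {i = i} f) ⟩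
  f i + sum (f ∘ punchIn i) + c  ≡⟨ cong (λ s → f i + s + c) ∑-rest ⟩
  f i + n * c + c                ≡⟨ +-assoc (f i) (n * c) c ⟩
  f i + (n * c + c)              ≡⟨ cong (f i +_) (+-comm (n * c) c) ⟩
  f i + suc n * c                ∎
  where
  open ≡-Reasoning
  ∑-rest : sum (f ∘ punchIn i) ≡ n * c
  ∑-rest = trans (sum-cong-≗ (λ j → f≡c (punchIn i j) (Finₚ.punchInᵢ≢i i j))) (∑-const n c)

∑-↑ : ∀ m n (f : Fin (m + n) → ℕ) → sum f ≡ ∑[ i < m ] f (i ↑ˡ n) + ∑[ j < n ] f (m ↑ʳ j)
∑-↑ zero    n f = refl
∑-↑ (suc m) n f = trans (cong (f zero +_) (∑-↑ m n (f ∘ suc))) (sym (+-assoc (f zero) _ _))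

∑-combine : ∀ m n (f : Fin (m * n) → ℕ) → sum f ≡ ∑[ i < m ] ∑[ j < n ] f (combine i j)
∑-combine zero    n f = refl
∑-combine (suc m) n f =
  trans (∑-↑ n (m * n) f) (cong (∑[ j < n ] f (j ↑ˡ (m * n)) +_) (∑-combine m n (f ∘ (n ↑ʳ_))))

x²+y²≡2xy+∣x-y∣² : ∀ x y → x * x + y * y ≡ 2 * (x * y) + ∣ x - y ∣ * ∣ x - y ∣
x²+y²≡2xy+∣x-y∣² x y with ≤-total x y
... | inj₁ x≤y with e , refl ← m≤n⇒∃[o]m+o≡n x≤y rewrite ∣m-m+n∣≡n x e = identity x e
  where
  identity : ∀ x e → x * x + (x + e) * (x + e) ≡ 2 * (x * (x + e)) + e * e
  identity = ℕ-Solver.solve-∀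
... | inj₂ y≤x with e , refl ← m≤n⇒∃[o]m+o≡n y≤x rewrite ∣-∣-comm (y + e) y | ∣m-m+n∣≡n y e = identity y e
  where
  identity : ∀ y e → (y + e) * (y + e) + y * y ≡ 2 * ((y + e) * y) + e * e
  identity = ℕ-Solver.solve-∀

-- The equality case of 2 ∑ f g ≤ ∑ f² + ∑ g², whose defect is ∑ ∣ f - g ∣².
∑f²≡∑fg≡∑g²⇒f≗g : ∀ {n} (f g : Fin n → ℕ) →
  ∑[ i < n ] (f i * f i) ≡ ∑[ i < n ] (f i * g i) →
  ∑[ i < n ] (g i * g i) ≡ ∑[ i < n ] (f i * g i) →
  ∀ i → f i ≡ g i
∑f²≡∑fg≡∑g²⇒f≗g {n} f g ∑ff≡∑fg ∑gg≡∑fg i =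
  ∣m-n∣≡0⇒m≡n ([ id , id ]′ (m*n≡0⇒m≡0∨n≡0 (d i) (∑≡0⇒≡0 (λ i → d i * d i) ∑dd≡0 i)))
  where
  open ≡-Reasoning
  d : Fin n → ℕ
  d i = ∣ f i - g i ∣
  S = ∑[ i < n ] (f i * g i)
  ∑dd = ∑[ i < n ] (d i * d i)
  ∑dd≡0 : ∑dd ≡ 0
  ∑dd≡0 = +-cancelˡ-≡ (2 * S) ∑dd 0 (begin
    2 * S + ∑dd                                 ≡⟨ cong (_+ ∑dd) (*-distribˡ-sum 2 (λ i → f i * g i)) ⟩
    ∑[ i < n ] (2 * (f i * g i)) + ∑dd          ≡⟨ ∑-distrib-+ (λ i → 2 * (f i * g i)) (λ i → d i * d i) ⟨
    ∑[ i < n ] (2 * (f i * g i) + d i * d i)    ≡⟨ sum-cong-≗ (λ i → x²+y²≡2xy+∣x-y∣² (f i) (g i)) ⟨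
    ∑[ i < n ] (f i * f i + g i * g i)          ≡⟨ ∑-distrib-+ (λ i → f i * f i) (λ i → g i * g i) ⟩
    ∑[ i < n ] (f i * f i) + ∑[ i < n ] (g i * g i) ≡⟨ cong₂ _+_ ∑ff≡∑fg ∑gg≡∑fg ⟩
    S + S                                       ≡⟨ cong (S +_) (+-identityʳ S) ⟨
    2 * S                                       ≡⟨ +-identityʳ (2 * S) ⟨
    2 * S + 0                                   ∎)

count*count≡∑∑ : ∀ {p q} (f : Fin p → Bool) (g : Fin q → Bool) →
  count f * count g ≡ ∑[ j < p ] ∑[ j′ < q ] ind (f j ∧ g j′)
count*count≡∑∑ {p} {q} f g = begin
  count f * count g                                   ≡⟨ cong₂ _*_ (count≡∑ f) (count≡∑ g) ⟩
  sum (ind ∘ f) * sum (ind ∘ g)                       ≡⟨ *-distribʳ-sum (sum (ind ∘ g)) (ind ∘ f) ⟩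
  ∑[ j < p ] (ind (f j) * sum (ind ∘ g))              ≡⟨ sum-cong-≗ (λ j → *-distribˡ-sum (ind (f j)) (ind ∘ g)) ⟩
  ∑[ j < p ] ∑[ j′ < q ] (ind (f j) * ind (g j′))    ≡⟨ sum-cong-≗ (λ j → sum-cong-≗ (λ j′ → ind-∧ (f j) (g j′))) ⟩
  ∑[ j < p ] ∑[ j′ < q ] ind (f j ∧ g j′)            ∎
  where
  open ≡-Reasoning
  ind-∧ : ∀ x y → ind x * ind y ≡ ind (x ∧ y)
  ind-∧ true  true  = refl
  ind-∧ true  false = refl
  ind-∧ false y     = refl

∑-count*count≡∑∑-concurrence : ∀ {v b p q} (N : Incidence v b) (x : Fin p → Fin v) (y : Fin q → Fin v) →
  ∑[ c < b ] (count (λ j → N (x j) c) * count (λ j′ → N (y j′) c))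
    ≡ ∑[ j < p ] ∑[ j′ < q ] concurrence N (x j) (y j′)
∑-count*count≡∑∑-concurrence {v} {b} {p} {q} N x y = begin
  ∑[ c < b ] (count (λ j → N (x j) c) * count (λ j′ → N (y j′) c))
    ≡⟨ sum-cong-≗ (λ c → count*count≡∑∑ (λ j → N (x j) c) (λ j′ → N (y j′) c)) ⟩
  ∑[ c < b ] ∑[ j < p ] ∑[ j′ < q ] both c j j′  ≡⟨ ∑-comm (λ c j → ∑[ j′ < q ] both c j j′) ⟩
  ∑[ j < p ] ∑[ c < b ] ∑[ j′ < q ] both c j j′  ≡⟨ sum-cong-≗ (λ j → ∑-comm (λ c j′ → both c j j′)) ⟩
  ∑[ j < p ] ∑[ j′ < q ] ∑[ c < b ] both c j j′
    ≡⟨ sum-cong-≗ (λ j → sum-cong-≗ (λ j′ → count≡∑ (λ c → N (x j) c ∧ N (y j′) c))) ⟨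
  ∑[ j < p ] ∑[ j′ < q ] concurrence N (x j) (y j′) ∎
  where
  open ≡-Reasoning
  both : Fin b → Fin p → Fin q → ℕ
  both c j j′ = ind (N (x j) c ∧ N (y j′) c)

double-counting : ∀ {v b k r} (N : Incidence v b) →
  (∀ c → count (λ x → N x c) ≡ k) → (∀ x → count (λ c → N x c) ≡ r) → b * k ≡ v * r
double-counting {v} {b} {k} {r} N blockSize replication = begin
  b * k                            ≡⟨ ∑-const b k ⟨
  ∑[ c < b ] k                     ≡⟨ sum-cong-≗ (λ c → trans (sym (blockSize c)) (count≡∑ (λ x → N x c))) ⟩
  ∑[ c < b ] ∑[ x < v ] ind (N x c) ≡⟨ ∑-comm (λ c x → ind (N x c)) ⟩
  ∑[ x < v ] ∑[ c < b ] ind (N x c) ≡⟨ sum-cong-≗ (λ x → trans (sym (count≡∑ (N x))) (replication x)) ⟩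
  ∑[ x < v ] r                     ≡⟨ ∑-const v r ⟩
  v * r                            ∎
  where open ≡-Reasoning

countRow : ∀ {m} n → (Fin (m * n) → Bool) → Fin m → ℕ
countRow n f i = count {n} (λ j → f (combine i j))

count-combine : ∀ m n (f : Fin (m * n) → Bool) → count f ≡ ∑[ i < m ] countRow n f i
count-combine m n f = begin
  count f                                    ≡⟨ count≡∑ f ⟩
  sum (ind ∘ f)                              ≡⟨ ∑-combine m n (ind ∘ f) ⟩
  ∑[ i < m ] ∑[ j < n ] ind (f (combine i j)) ≡⟨ sum-cong-≗ (λ i → count≡∑ (λ j → f (combine {m} i j))) ⟨
  ∑[ i < m ] countRow n f i                  ∎
  where open ≡-Reasoning

quotient-combine : ∀ {m} n (i : Fin m) (j : Fin n) → quotient n (combine i j) ≡ i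
quotient-combine n i j = cong proj₁ (Finₚ.remQuot-combine i j)

remainder-combine : ∀ {m} n (i : Fin m) (j : Fin n) → remainder {m} n (combine i j) ≡ j
remainder-combine n i j = cong proj₂ (Finₚ.remQuot-combine i j)

==-true : ∀ {n} {x y : Fin n} → x ≡ y → (x == y) ≡ true
==-true {x = x} {y} x≡y = trans (isYes≗does (x Finₚ.≟ y)) (dec-true (x Finₚ.≟ y) x≡y)

==-false : ∀ {n} {x y : Fin n} → x ≢ y → (x == y) ≡ false
==-false {x = x} {y} x≢y = trans (isYes≗does (x Finₚ.≟ y)) (dec-false (x Finₚ.≟ y) x≢y)

count-quotient∧ : ∀ m n (f : Fin (m * n) → Bool) (i : Fin m) →
  count (λ x → (quotient n x == i) ∧ f x) ≡ countRow n f i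
count-quotient∧ m n f i = begin
  count (λ x → (quotient n x == i) ∧ f x)   ≡⟨ count-combine m n _ ⟩
  sum inRow                                 ≡⟨ +-identityʳ (sum inRow) ⟨
  sum inRow + 0                             ≡⟨ ∑-except i inRow elsewhere ⟩
  inRow i + m * 0                           ≡⟨ cong₂ _+_ here (*-zeroʳ m) ⟩
  countRow n f i + 0                        ≡⟨ +-identityʳ _ ⟩
  countRow n f i                            ∎
  where
  open ≡-Reasoning
  inRow : Fin m → ℕ
  inRow = countRow n (λ x → (quotient n x == i) ∧ f x)
  here : inRow i ≡ countRow n f i
  here = count-cong (λ j → cong (_∧ f (combine i j)) (==-true (quotient-combine n i j)))
  elsewhere : ∀ i′ → i′ ≢ i → inRow i′ ≡ 0
  elsewhere i′ i′≢i = trans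
    (count-cong (λ j → cong (_∧ f (combine i′ j)) (==-false (i′≢i ∘ trans (sym (quotient-combine n i′ j))))))
    (count-false n)

count-quotient : ∀ m n (i : Fin m) → count (λ x → quotient {m} n x == i) ≡ n
count-quotient m n i = begin
  count (λ x → quotient n x == i)             ≡⟨ count-cong (λ x → ∧-identityʳ (quotient {m} n x == i)) ⟨
  count (λ x → (quotient n x == i) ∧ true)    ≡⟨ count-quotient∧ m n (λ _ → true) i ⟩
  count {n} (λ _ → true)                      ≡⟨ count-true n ⟩
  n                                           ∎
  where open ≡-Reasoning

θ₂≡⊖ : ∀ n r l₁ l₂ l₃ → θ₂ n r l₁ l₂ l₃ ≡ (r + l₃ + n * l₁) ⊖ (l₂ + l₁ + n * l₃)
θ₂≡⊖ n r l₁ l₂ l₃ = begin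
  θ₂ n r l₁ l₂ l₃                                        ≡⟨ identity (ℤ.+ r) (ℤ.+ n) (ℤ.+ l₁) (ℤ.+ l₂) (ℤ.+ l₃) ⟩
  ℤ.+ r ℤ.+ ℤ.+ l₃ ℤ.+ ℤ.+ n ℤ.* ℤ.+ l₁ ℤ.- (ℤ.+ l₂ ℤ.+ ℤ.+ l₁ ℤ.+ ℤ.+ n ℤ.* ℤ.+ l₃)
    ≡⟨ cong₂ ℤ._-_ (pos-affine r l₃ n l₁) (pos-affine l₂ l₁ n l₃) ⟨
  ℤ.+ (r + l₃ + n * l₁) ℤ.- ℤ.+ (l₂ + l₁ + n * l₃)       ≡⟨ ℤₚ.[+m]-[+n]≡m⊖n (r + l₃ + n * l₁) (l₂ + l₁ + n * l₃) ⟩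
  (r + l₃ + n * l₁) ⊖ (l₂ + l₁ + n * l₃)                 ∎
  where
  open ≡-Reasoning
  identity : ∀ R N L₁ L₂ L₃ →
    (R ℤ.- L₂) ℤ.+ ((N ℤ.- 1ℤ) ℤ.* (L₁ ℤ.- L₃)) ≡ R ℤ.+ L₃ ℤ.+ N ℤ.* L₁ ℤ.- (L₂ ℤ.+ L₁ ℤ.+ N ℤ.* L₃)
  identity = ℤ-Solver.solve-∀
  pos-affine : ∀ a b c d → ℤ.+ (a + b + c * d) ≡ ℤ.+ a ℤ.+ ℤ.+ b ℤ.+ ℤ.+ c ℤ.* ℤ.+ d
  pos-affine a b c d = trans (ℤₚ.pos-+ (a + b) (c * d)) (cong₂ ℤ._+_ (ℤₚ.pos-+ a b) (ℤₚ.pos-* c d))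

θ₃≡⊖ : ∀ r l₁ l₂ l₃ → θ₃ r l₁ l₂ l₃ ≡ (r + l₃) ⊖ (l₁ + l₂)
θ₃≡⊖ r l₁ l₂ l₃ = begin
  θ₃ r l₁ l₂ l₃                              ≡⟨ identity (ℤ.+ r) (ℤ.+ l₁) (ℤ.+ l₂) (ℤ.+ l₃) ⟩
  ℤ.+ r ℤ.+ ℤ.+ l₃ ℤ.- (ℤ.+ l₁ ℤ.+ ℤ.+ l₂)   ≡⟨ cong₂ ℤ._-_ (ℤₚ.pos-+ r l₃) (ℤₚ.pos-+ l₁ l₂) ⟨
  ℤ.+ (r + l₃) ℤ.- ℤ.+ (l₁ + l₂)             ≡⟨ ℤₚ.[+m]-[+n]≡m⊖n (r + l₃) (l₁ + l₂) ⟩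
  (r + l₃) ⊖ (l₁ + l₂)                       ∎
  where
  open ≡-Reasoning
  identity : ∀ R L₁ L₂ L₃ → R ℤ.- L₁ ℤ.- L₂ ℤ.+ L₃ ≡ R ℤ.+ L₃ ℤ.- (L₁ ℤ.+ L₂)
  identity = ℤ-Solver.solve-∀

θ₁-one : ∀ r l₁ l₂ l₃ → θ₁ 1 r l₁ l₂ l₃ ≡ r ⊖ l₁
θ₁-one r l₁ l₂ l₃ = trans (ℤₚ.+-identityʳ _) (ℤₚ.[+m]-[+n]≡m⊖n r l₁)

m⊖n≡0⇒m≡n : ∀ {m n} → m ⊖ n ≡ 0ℤ → m ≡ n
m⊖n≡0⇒m≡n {m} {n} m⊖n≡0 =
  ℤₚ.+-injective (ℤₚ.i-j≡0⇒i≡j (ℤ.+ m) (ℤ.+ n) (trans (ℤₚ.[+m]-[+n]≡m⊖n m n) m⊖n≡0))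

0<m⊖n⇒n<m : ∀ {m n} → 0ℤ ℤ.< m ⊖ n → n < m
0<m⊖n⇒n<m {m} {n} 0<m⊖n with n <? m
... | yes n<m = n<m
... | no  n≮m = contradiction
  (ℤₚ.<-≤-trans 0<m⊖n (subst (m ⊖ n ℤ.≤_) (ℤₚ.n⊖n≡0 m) (ℤₚ.⊖-monoʳ-≥-≤ m (≮⇒≥ n≮m))))
  (ℤₚ.<-irrefl refl)

n<m⇒0<m⊖n : ∀ {m n} → n < m → 0ℤ ℤ.< m ⊖ n
n<m⇒0<m⊖n {m} {n} n<m = subst (ℤ._< m ⊖ n) (ℤₚ.n⊖n≡0 m) (ℤₚ.⊖-monoʳ->-< m n<m)

affine-< : ∀ {a b c d m t} → t ≤ m → a < b → a + m * c < b + m * d → a + t * c < b + t * d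
affine-< {a} {b} {c} {d} {m} {t} t≤m a<b am<bm with ≤-total c d
... | inj₁ c≤d = +-mono-<-≤ a<b (*-monoʳ-≤ t c≤d)
... | inj₂ d≤c with e , refl ← m≤n⇒∃[o]m+o≡n d≤c = begin-strict
  a + t * (d + e)   ≡⟨ split a t d e ⟩
  a + t * e + t * d ≤⟨ +-monoˡ-≤ (t * d) (+-monoʳ-≤ a (*-monoˡ-≤ e t≤m)) ⟩
  a + m * e + t * d <⟨ +-monoˡ-< (t * d) (+-cancelʳ-< (m * d) (a + m * e) b
                         (subst (_< b + m * d) (split a m d e) am<bm)) ⟩
  b + t * d         ∎
  where
  open ≤-Reasoning
  split : ∀ a t d e → a + t * (d + e) ≡ a + t * e + t * d
  split = ℕ-Solver.solve-∀

-- θ₁ m r l₁ l₂ l₃ is θ₂ m r l₂ l₁ l₃ by definition, hence the swapped arguments of θ₂≡⊖.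
θ₁-positive-between : ∀ {m t} r l₁ l₂ l₃ → t ≤ m →
  0ℤ ℤ.< θ₃ r l₁ l₂ l₃ → 0ℤ ℤ.< θ₁ m r l₁ l₂ l₃ → 0ℤ ℤ.< θ₁ t r l₁ l₂ l₃
θ₁-positive-between {m} {t} r l₁ l₂ l₃ t≤m 0<θ₃ 0<θ₁ =
  subst (0ℤ ℤ.<_) (sym (θ₂≡⊖ t r l₂ l₁ l₃)) (n<m⇒0<m⊖n (affine-< t≤m at-0 at-m))
  where
  at-0 : l₁ + l₂ < r + l₃
  at-0 = 0<m⊖n⇒n<m (subst (0ℤ ℤ.<_) (θ₃≡⊖ r l₁ l₂ l₃) 0<θ₃)
  at-m : l₁ + l₂ + m * l₃ < r + l₃ + m * l₂
  at-m = 0<m⊖n⇒n<m (subst (0ℤ ℤ.<_) (θ₂≡⊖ m r l₂ l₁ l₃) 0<θ₁)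

someBlock : ∀ {v b r} (N : Incidence v b) → (∀ x → count (λ c → N x c) ≡ r) → Fin v → 0 < r → Fin b
someBlock {b = zero}  N replication x 0<r = contradiction (replication x) (<⇒≢ 0<r)
someBlock {b = suc _} N replication x 0<r = zero

module _ {m n b r k l₁ l₂ l₃ : ℕ} {N : Incidence (m * n) b} (D : IsRD m n b r k l₁ l₂ l₃ N) where
  open IsRD D

  concurrence-self : ∀ x → concurrence N x x ≡ r
  concurrence-self x = trans (count-cong (λ c → ∧-idem (N x c))) (replication x)

  ∑-concurrence-sameRow : ∀ (i : Fin m) (j : Fin n) →
    ∑[ j′ < n ] concurrence N (combine i j) (combine i j′) + l₁ ≡ r + n * l₁
  ∑-concurrence-sameRow i j =
    trans (∑-except j _ (λ j′ j′≢j → sameRow i j j′ (j′≢j ∘ sym)))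
          (cong (_+ n * l₁) (concurrence-self (combine i j)))

  ∑-concurrence-otherRow : ∀ {i i′ : Fin m} → i ≢ i′ → ∀ (j : Fin n) →
    ∑[ j′ < n ] concurrence N (combine i j) (combine i′ j′) + l₃ ≡ l₂ + n * l₃
  ∑-concurrence-otherRow {i} {i′} i≢i′ j =
    trans (∑-except j _ (λ j′ j′≢j → other i i′ j j′ i≢i′ (j′≢j ∘ sym)))
          (cong (_+ n * l₃) (sameCol i i′ j i≢i′))

  ∑-countRow*countRow : ∀ (i i′ : Fin m) →
    ∑[ c < b ] (countRow n (transpose N c) i * countRow n (transpose N c) i′)
      ≡ ∑[ j < n ] ∑[ j′ < n ] concurrence N (combine i j) (combine i′ j′)
  ∑-countRow*countRow i i′ = ∑-count*count≡∑∑-concurrence N (combine i) (combine i′)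

  module _ (θ₂≡0 : θ₂ n r l₁ l₂ l₃ ≡ 0ℤ) where

    ∑-concurrence-sameRow≡otherRow : ∀ {i i′ : Fin m} → i ≢ i′ → ∀ (j : Fin n) →
      ∑[ j′ < n ] concurrence N (combine i j) (combine i j′)
        ≡ ∑[ j′ < n ] concurrence N (combine i j) (combine i′ j′)
    ∑-concurrence-sameRow≡otherRow {i} {i′} i≢i′ j = +-cancelʳ-≡ (l₁ + l₃) A B (begin
      A + (l₁ + l₃)        ≡⟨ +-assoc A l₁ l₃ ⟨
      A + l₁ + l₃          ≡⟨ cong (_+ l₃) (∑-concurrence-sameRow i j) ⟩
      r + n * l₁ + l₃      ≡⟨ +-Semigroup.xy∙z≈xz∙y r (n * l₁) l₃ ⟩
      r + l₃ + n * l₁      ≡⟨ m⊖n≡0⇒m≡n (trans (sym (θ₂≡⊖ n r l₁ l₂ l₃)) θ₂≡0) ⟩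
      l₂ + l₁ + n * l₃     ≡⟨ +-Semigroup.xy∙z≈xz∙y l₂ l₁ (n * l₃) ⟩
      l₂ + n * l₃ + l₁     ≡⟨ cong (_+ l₁) (∑-concurrence-otherRow i≢i′ j) ⟨
      B + l₃ + l₁          ≡⟨ +-assoc B l₃ l₁ ⟩
      B + (l₃ + l₁)        ≡⟨ cong (B +_) (+-comm l₃ l₁) ⟩
      B + (l₁ + l₃)        ∎)
      where
      open ≡-Reasoning
      A = ∑[ j′ < n ] concurrence N (combine i j) (combine i j′)
      B = ∑[ j′ < n ] concurrence N (combine i j) (combine i′ j′)

    countRow-independent : ∀ (c : Fin b) (i i′ : Fin m) →
      countRow n (transpose N c) i ≡ countRow n (transpose N c) i′
    countRow-independent c i i′ with i Finₚ.≟ i′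
    ... | yes refl = refl
    ... | no i≢i′  = ∑f²≡∑fg≡∑g²⇒f≗g (meet i) (meet i′) (∑-square≡∑-product i≢i′)
      (trans (∑-square≡∑-product (i≢i′ ∘ sym)) (sum-cong-≗ (λ c → *-comm (meet i′ c) (meet i c)))) c
      where
      meet : Fin m → Fin b → ℕ
      meet i c = countRow n (transpose N c) i
      ∑-square≡∑-product : ∀ {i i′ : Fin m} → i ≢ i′ →
        ∑[ c < b ] (meet i c * meet i c) ≡ ∑[ c < b ] (meet i c * meet i′ c)
      ∑-square≡∑-product {i} {i′} i≢i′ = trans (∑-countRow*countRow i i)
        (trans (sum-cong-≗ (∑-concurrence-sameRow≡otherRow i≢i′)) (sym (∑-countRow*countRow i i′)))

    blockSize≡m*countRow : ∀ (c : Fin b) (i : Fin m) → k ≡ m * countRow n (transpose N c) i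
    blockSize≡m*countRow c i = begin
      k                                            ≡⟨ blockSize c ⟨
      count (transpose N c)                        ≡⟨ count-combine m n (transpose N c) ⟩
      ∑[ i′ < m ] countRow n (transpose N c) i′    ≡⟨ sum-cong-≗ (λ i′ → countRow-independent c i′ i) ⟩
      ∑[ i′ < m ] countRow n (transpose N c) i     ≡⟨ ∑-const m _ ⟩
      m * countRow n (transpose N c) i             ∎
      where open ≡-Reasoning

    countRow≡k/m : ⦃ _ : NonZero m ⦄ → ∀ (c : Fin b) (i : Fin m) →
      countRow n (transpose N c) i ≡ k / m
    countRow≡k/m c i =
      sym (trans (cong (_/ m) (trans (blockSize≡m*countRow c i) (*-comm m _))) (m*n/n≡m _ m))

resolvableByRows : ∀ {v m n r k α} (N : Incidence v (m * n)) → m * α ≡ r → n * k ≡ v * α →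
  (∀ (x : Fin v) (i : Fin m) → countRow n (N x) i ≡ α) → Resolvable v (m * n) r k α N
resolvableByRows {m = m} {n} {k = k} N m*α≡r n*k≡v*α meets =
  m , quotient n , m*α≡r ,
  (λ i → trans (cong (_* k) (count-quotient m n i)) n*k≡v*α) ,
  (λ i x → trans (count-quotient∧ m n (N x) i) (meets x i))

uniformColumnTactical : ∀ {m n b α} (N : Incidence (m * n) b) →
  (∀ (c : Fin b) (i : Fin m) → countRow n (transpose N c) i ≡ α) →
  UniformColumnTacticalWRT N (rowOfA m n)
uniformColumnTactical {m} {n} {b} {α} N meets =
  b , id , (λ c → c , refl) , α ,
  λ i _ c _ → trans (count-quotient∧ m n (transpose N c) i) (meets c i)

squareTactical : ∀ {m n α} (N : Incidence (m * n) (m * n)) →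
  (∀ (c : Fin (m * n)) (i : Fin m) → countRow n (transpose N c) i ≡ α) →
  (∀ (x : Fin (m * n)) (i : Fin m) → countRow n (N x) i ≡ α) →
  SquareTacticalDecomposable n N
squareTactical {m} {n} {α} N meets dualMeets =
  m , m , quotient n , quotient n , count-quotient m n , count-quotient m n ,
  (λ _ j → α , λ x _ → trans (count-quotient∧ m n (N x) j) (dualMeets x j)) ,
  (λ i _ → α , λ c _ → trans (count-quotient∧ m n (transpose N c) i) (meets c i))

dual-resolvable : ∀ {m n b r k l₁ l₂ l₃ α} ⦃ _ : NonZero m ⦄ {N : Incidence (m * n) b} →
  IsRD m n b r k l₁ l₂ l₃ N → m * α ≡ k →
  (∀ (c : Fin b) (i : Fin m) → countRow n (transpose N c) i ≡ α) →
  Resolvable b (m * n) k r α (transpose N)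
dual-resolvable {m} {n} {b} {r} {k} {α = α} {N} D m*α≡k meets =
  resolvableByRows {m = m} {n} (transpose N) m*α≡k n*r≡b*α meets
  where
  open ≡-Reasoning
  n*r≡b*α : n * r ≡ b * α
  n*r≡b*α = *-cancelˡ-≡ (n * r) (b * α) m (begin
    m * (n * r)  ≡⟨ *-assoc m n r ⟨
    m * n * r    ≡⟨ double-counting N (IsRD.blockSize D) (IsRD.replication D) ⟨
    b * k        ≡⟨ cong (b *_) m*α≡k ⟨
    b * (m * α)  ≡⟨ *-Semigroup.x∙yz≈y∙xz b m α ⟩
    m * (b * α)  ∎)

embedRows : ∀ {t m} n → (Fin t → Fin m) → Fin (t * n) → Fin (m * n)
embedRows {t} n ι x = combine (ι (quotient n x)) (remainder {t} n x)

embedRows-combine : ∀ {t m} n (ι : Fin t → Fin m) (i : Fin t) (j : Fin n) →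
  embedRows n ι (combine i j) ≡ combine (ι i) j
embedRows-combine n ι i j =
  cong₂ (λ i′ j′ → combine (ι i′) j′) (quotient-combine n i j) (remainder-combine n i j)

restrictRows : ∀ {t m b} n → (Fin t → Fin m) → Incidence (m * n) b → Incidence (t * n) b
restrictRows n ι N x = N (embedRows n ι x)

restrictRows-isRD : ∀ {t m n b r k l₁ l₂ l₃ α} {N : Incidence (m * n) b} (ι : Fin t → Fin m) →
  Injective _≡_ _≡_ ι → IsRD m n b r k l₁ l₂ l₃ N →
  (∀ (c : Fin b) (i : Fin m) → countRow n (transpose N c) i ≡ α) →
  IsRD t n b r (α * t) l₁ l₂ l₃ (restrictRows n ι N)
restrictRows-isRD {t} {n = n} {α = α} {N} ι ι-injective D meets = record
  { blockSize   = blockSize′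
  ; replication = replication ∘ embedRows n ι
  ; sameRow     = λ i j j′ j≢j′ → trans (concurrence-embed i j i j′) (sameRow (ι i) j j′ j≢j′)
  ; sameCol     = λ i i′ j i≢i′ →
      trans (concurrence-embed i j i′ j) (sameCol (ι i) (ι i′) j (i≢i′ ∘ ι-injective))
  ; other       = λ i i′ j j′ i≢i′ j≢j′ →
      trans (concurrence-embed i j i′ j′) (other (ι i) (ι i′) j j′ (i≢i′ ∘ ι-injective) j≢j′)
  }
  where
  open IsRD D
  open ≡-Reasoning
  N′ = restrictRows n ι N
  concurrence-embed : ∀ i j i′ j′ →
    concurrence N′ (combine i j) (combine i′ j′) ≡ concurrence N (combine (ι i) j) (combine (ι i′) j′)
  concurrence-embed i j i′ j′ =
    cong₂ (concurrence N) (embedRows-combine n ι i j) (embedRows-combine n ι i′ j′)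
  blockSize′ : ∀ c → count (transpose N′ c) ≡ α * t
  blockSize′ c = begin
    count (transpose N′ c)                  ≡⟨ count-combine t n (transpose N′ c) ⟩
    ∑[ i < t ] countRow n (transpose N′ c) i
      ≡⟨ sum-cong-≗ (λ i → trans (count-cong (λ j → cong (transpose N c) (embedRows-combine n ι i j)))
                                 (meets c (ι i))) ⟩
    ∑[ i < t ] α                            ≡⟨ ∑-const t α ⟩
    t * α                                   ≡⟨ *-comm t α ⟩
    α * t                                   ∎

SemiRegularResolvableRD : (t n α l₁ l₂ l₃ : ℕ) → Set
SemiRegularResolvableRD t n α l₁ l₂ l₃ =
  Σ ℕ λ b′ → Σ ℕ λ r′ → Σ (Incidence (t * n) b′) λ N′ →
    IsRD t n b′ r′ (α * t) l₁ l₂ l₃ N′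
    × SemiRegularII t n r′ l₁ l₂ l₃
    × Resolvable (t * n) b′ r′ (α * t) α N′

module SelfDualRD {m n r k l₁ l₂ l₃ : ℕ} ⦃ _ : NonZero m ⦄ ⦃ _ : NonZero n ⦄
  {N : Incidence (m * n) (m * n)} (D : IsRD m n (m * n) r k l₁ l₂ l₃ N)
  (D* : IsRD m n (m * n) r k l₁ l₂ l₃ (λ x y → N y (cast refl x)))
  (θ₂≡0 : θ₂ n r l₁ l₂ l₃ ≡ 0ℤ) (m*α≡k : m * (k / m) ≡ k) where

  dualMeets : ∀ (x : Fin (m * n)) (i : Fin m) → countRow n (N x) i ≡ k / m
  dualMeets x i = trans (count-cong (λ j → cong (N x) (sym (Finₚ.cast-is-id refl (combine i j)))))
                        (countRow≡k/m D* θ₂≡0 x i)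

  m*α≡r : m * (k / m) ≡ r
  m*α≡r = trans m*α≡k (*-cancelˡ-≡ k r (m * n) ⦃ m*n≢0 m n ⦄
    (double-counting N (IsRD.blockSize D) (IsRD.replication D)))

selfDual-resolvable×STD : ∀ {m n b r k l₁ l₂ l₃} ⦃ _ : NonZero m ⦄ ⦃ _ : NonZero n ⦄
  {N : Incidence (m * n) b} → IsRD m n b r k l₁ l₂ l₃ N → θ₂ n r l₁ l₂ l₃ ≡ 0ℤ →
  m * (k / m) ≡ k → SelfDual m n b r k l₁ l₂ l₃ N →
  Resolvable (m * n) b r k (k / m) N × SquareTacticalDecomposable n N
selfDual-resolvable×STD {m} {n} {k = k} {N = N} D θ₂≡0 m*α≡k (refl , D*) =
  resolvableByRows {m = m} {n} N m*α≡r n*k≡[m*n]*α dualMeets ,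
  squareTactical N (countRow≡k/m D θ₂≡0) dualMeets
  where
  open SelfDualRD D D* θ₂≡0 m*α≡k
  n*k≡[m*n]*α : n * k ≡ m * n * (k / m)
  n*k≡[m*n]*α = trans (cong (n *_) (sym m*α≡k))
    (trans (*-Semigroup.x∙yz≈y∙xz n m (k / m)) (sym (*-assoc m n (k / m))))

selfDual-restriction : ∀ {m n b r k l₁ l₂ l₃} ⦃ _ : NonZero m ⦄ ⦃ _ : NonZero n ⦄
  {N : Incidence (m * n) b} → IsRD m n b r k l₁ l₂ l₃ N → SemiRegularII m n r l₁ l₂ l₃ →
  m * (k / m) ≡ k → SelfDual m n b r k l₁ l₂ l₃ N →
  ∀ t → t ≤ m → SemiRegularResolvableRD t n (k / m) l₁ l₂ l₃
selfDual-restriction {m} {n} {r = r} {k} {l₁} {l₂} {l₃} {N}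
  D (θ₂≡0 , 0<θ₁ , 0<θ₃) m*α≡k (refl , D*) t t≤m =
  m * n , r , restrictRows n ι N ,
  restrictRows-isRD ι (Finₚ.inject≤-injective t≤m t≤m _ _) D (countRow≡k/m D θ₂≡0) ,
  (θ₂≡0 , θ₁-positive-between r l₁ l₂ l₃ t≤m 0<θ₃ 0<θ₁ , 0<θ₃) ,
  resolvableByRows {m = m} {n} (restrictRows n ι N) m*α≡r n*[α*t]≡[t*n]*α
    (dualMeets ∘ embedRows n ι)
  where
  open SelfDualRD D D* θ₂≡0 m*α≡k
  ι : Fin t → Fin m
  ι i = inject≤ i t≤m
  n*[α*t]≡[t*n]*α : n * (k / m * t) ≡ t * n * (k / m)
  n*[α*t]≡[t*n]*α = identity n t (k / m)
    where
    identity : ∀ n t α → n * (α * t) ≡ t * n * α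
    identity = ℕ-Solver.solve-∀

theorem1 : ∀ (m n b r k l₁ l₂ l₃ : ℕ) ⦃ _ : NonZero m ⦄ ⦃ _ : NonZero n ⦄
    (N : Incidence (m * n) b) →
    IsRD m n b r k l₁ l₂ l₃ N →
    SemiRegularII m n r l₁ l₂ l₃ →
    -- (i)
    (m ∣ k)
    × (∀ (c : Fin b) (i : Fin m) → count (λ j → N (combine i j) c) ≡ k / m)
    -- (ii)
    × UniformColumnTacticalWRT N (rowOfA m n)
    -- (iii)
    × Resolvable b (m * n) k r (k / m) (transpose N)
    -- (iv)
    × (SelfDual m n b r k l₁ l₂ l₃ N →
        Resolvable (m * n) b r k (k / m) N × SquareTacticalDecomposable n N)
    -- (v)
    × (SelfDual m n b r k l₁ l₂ l₃ N →
        ∀ (s : ℕ) → 1 ≤ s → s ≤ m ∸ 1 →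
        Σ ℕ λ b′ → Σ ℕ λ r′ → Σ (Incidence ((m ∸ s) * n) b′) λ N′ →
          IsRD (m ∸ s) n b′ r′ ((k / m) * (m ∸ s)) l₁ l₂ l₃ N′
          × SemiRegularII (m ∸ s) n r′ l₁ l₂ l₃
          × Resolvable ((m ∸ s) * n) b′ r′ ((k / m) * (m ∸ s)) (k / m) N′)
theorem1 m@(suc _) n@(suc _) b r k l₁ l₂ l₃ N D semiRegular@(θ₂≡0 , 0<θ₁ , 0<θ₃) =
  divides (k / m) (trans (sym m*α≡k) (*-comm m (k / m))) ,
  meets ,
  uniformColumnTactical N meets ,
  dual-resolvable D m*α≡k meets ,
  selfDual-resolvable×STD D θ₂≡0 m*α≡k ,
  λ selfDual s _ _ → selfDual-restriction D semiRegular m*α≡k selfDual (m ∸ s) (m∸n≤m m s)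
  where
  meets : ∀ (c : Fin b) (i : Fin m) → countRow n (transpose N c) i ≡ k / m
  meets = countRow≡k/m D θ₂≡0
  l₁<r : l₁ < r
  l₁<r = 0<m⊖n⇒n<m (subst (0ℤ ℤ.<_) (θ₁-one r l₁ l₂ l₃)
    (θ₁-positive-between {m} r l₁ l₂ l₃ (s≤s z≤n) 0<θ₃ 0<θ₁))
  c₀ : Fin b
  c₀ = someBlock N (IsRD.replication D) zero (≤-<-trans z≤n l₁<r)
  m*α≡k : m * (k / m) ≡ k
  m*α≡k = sym (trans (blockSize≡m*countRow D θ₂≡0 c₀ zero) (cong (m *_) (meets c₀ zero)))
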